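{- Let $F$ be a field and $a\in F$ such that $-1\notin F^2$, $a\notin F^2$ and $-a\notin F^2$. Then for every $n\in\mathbb{N}$ and any root $\sqrt[2^n]{a}$ of $X^{2^n}-a$ in an algebraic closure of $F$, we have $\sqrt{ -1}\notin F[\sqrt[2^n]{a}]$.
   Context: $F^2=\{x^2:x\in F\}$; $\sqrt{ -1}$ denotes a root of $X^2+1$ in the algebraic closure. -}

module Defs where

open import Level using (_⊔_) renaming (suc to lsuc)
open import Data.Nat using (ℕ; zero; suc)
open import Data.List using (List; []; _∷_)
open import Data.Product using (∃; Σ; _×_)
open import Relation.Nullary using (¬_)
open import Algebra.Bundles using (CommutativeRing)
open import Algebra.Morphism.Structures using (module RingMorphisms)

record Field (c ℓ : Level.Level) : Set (lsuc (c ⊔ ℓ)) where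
  field
    commutativeRing : CommutativeRing c ℓ
  open CommutativeRing commutativeRing public
  field
    1≉0     : ¬ (1# ≈ 0#)
    inverse : ∀ x → ¬ (x ≈ 0#) → ∃ λ y → (x * y) ≈ 1#

module _ {c ℓ} (F : Field c ℓ) where
  open Field F

  IsSquare : Carrier → Set (c ⊔ ℓ)
  IsSquare x = ∃ λ y → (y * y) ≈ x

  pow : Carrier → ℕ → Carrier
  pow x zero    = 1#
  pow x (suc n) = x * pow x n

-- A field extension K / F, given by a ring homomorphism ι : F → K
-- (automatically injective since F is a field).
record Extension {c ℓ} (F : Field c ℓ) (c′ ℓ′ : Level.Level)
       : Set (c ⊔ ℓ ⊔ lsuc (c′ ⊔ ℓ′)) where
  field
    K     : Field c′ ℓ′
    ι     : Field.Carrier F → Field.Carrier K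
    ι-hom : RingMorphisms.IsRingHomomorphism
              (Field.rawRing F) (Field.rawRing K) ι

module _ {c ℓ c′ ℓ′} {F : Field c ℓ} (E : Extension F c′ ℓ′) where
  open Extension E
  open Field K

  evalAt : Carrier → List (Field.Carrier F) → Carrier
  evalAt α []       = 0#
  evalAt α (c ∷ cs) = ι c + α * evalAt α cs

  InAdjoin : Carrier → Carrier → Set (c ⊔ ℓ′)
  InAdjoin α z = ∃ λ (cs : List (Field.Carrier F)) → z ≈ evalAt α cs

{-# OPTIONS --safe #-}
-- Adjoin g = α^(2^k) for k = n-1, …, 0 in turn, each a square root of the previous one (starting from a).
-- In a step S ⊆ S[g] with g² = γ ∈ S and -1, γ, -γ non-squares in S, the elements 1 and g are
-- independent over S, and comparing coordinates in (x + y g)² = (x² + γy²) + 2xy g shows that -1, g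
-- and -g are non-squares in S[g].  So -1 stays a non-square up to a field containing F and α.
module Submission where

open import Defs
open import Level using (_⊔_)
open import Data.Nat as ℕ using (ℕ; zero; suc; _^_)
import Data.Nat.Properties as ℕ
open import Data.List using (List; []; _∷_; map)
open import Data.List.Relation.Unary.All as All using (All; []; _∷_)
open import Data.Product using (∃; ∃₂; _×_; _,_)
open import Relation.Nullary using (¬_)
open import Function using (_∘′_)
open import Relation.Unary using (Pred; _∈_; _⊆_)
open import Relation.Binary.Definitions using (_Respects_)
import Relation.Binary.PropositionalEquality as ≡
open import Algebra.Morphism.Structures using (module RingMorphisms)

module _ {c ℓ} (K : Field c ℓ) where
  open Field K
  open import Algebra.Properties.Ring ring
    using (-‿distribʳ-*; -‿distribˡ-*; -1*x≈-x; [y-z]x≈yx-zx)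
  open import Algebra.Properties.Group +-group
    using (inverseˡ-unique; ε⁻¹≈ε; ⁻¹-involutive; x∙y⁻¹≈ε⇒x≈y; ∙-cancelʳ; y≈x\\z; //-rightDividesʳ)
  open import Algebra.Properties.AbelianGroup +-abelianGroup using (⁻¹-∙-comm)
  open import Algebra.Solver.Ring.NaturalCoefficients.Default commutativeSemiring
    using (solve; _:=_; _:+_; _:*_)
  open import Relation.Binary.Reasoning.Setoid setoid

  SquareIn : ∀ {p} → Pred Carrier p → Pred Carrier (c ⊔ ℓ ⊔ p)
  SquareIn S t = ∃ λ y → y ∈ S × y * y ≈ t

  SquareIn-resp-≈ : ∀ {p} {S : Pred Carrier p} → SquareIn S Respects _≈_
  SquareIn-resp-≈ t≈t′ (y , y∈S , y*y≈t) = y , y∈S , trans y*y≈t t≈t′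

  SquareIn-mono : ∀ {p q} {S : Pred Carrier p} {T : Pred Carrier q} → S ⊆ T → SquareIn S ⊆ SquareIn T
  SquareIn-mono S⊆T (y , y∈S , y*y≈t) = y , S⊆T y∈S , y*y≈t

  record IsSubfield {p} (S : Pred Carrier p) : Set (c ⊔ ℓ ⊔ p) where
    field
      ∈-resp-≈  : S Respects _≈_
      0∈        : 0# ∈ S
      1∈        : 1# ∈ S
      +-closed  : ∀ {x y} → x ∈ S → y ∈ S → x + y ∈ S
      *-closed  : ∀ {x y} → x ∈ S → y ∈ S → x * y ∈ S
      -‿closed  : ∀ {x} → x ∈ S → - x ∈ S
      ⁻¹-closed : ∀ {x} → x ∈ S → ¬ x ≈ 0# → ∃ λ y → y ∈ S × x * y ≈ 1#

  x*y≈0⇒x≈0 : ∀ {x y} → ¬ y ≈ 0# → x * y ≈ 0# → x ≈ 0#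
  x*y≈0⇒x≈0 {x} {y} y≉0 x*y≈0 = let (v , y*v≈1) = inverse y y≉0 in begin
    x            ≈⟨ *-identityʳ x ⟨
    x * 1#       ≈⟨ *-congˡ y*v≈1 ⟨
    x * (y * v)  ≈⟨ *-assoc x y v ⟨
    (x * y) * v  ≈⟨ *-congʳ x*y≈0 ⟩
    0# * v       ≈⟨ zeroˡ v ⟩
    0#           ∎

  -x≈0⇒x≈0 : ∀ {x} → - x ≈ 0# → x ≈ 0#
  -x≈0⇒x≈0 {x} -x≈0 = trans (sym (⁻¹-involutive x)) (trans (-‿cong -x≈0) ε⁻¹≈ε)

  horner : Carrier → List Carrier → Carrier
  horner α []       = 0#
  horner α (w ∷ ws) = w + α * horner α ws

  PolyValues : ∀ {p} → Pred Carrier p → Carrier → Pred Carrier (c ⊔ ℓ ⊔ p)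
  PolyValues S α z = ∃ λ ws → All S ws × z ≈ horner α ws

  PolyValues-mono : ∀ {p q} {S : Pred Carrier p} {T : Pred Carrier q} {α} →
                    S ⊆ T → PolyValues S α ⊆ PolyValues T α
  PolyValues-mono S⊆T (ws , ws∈S , z≈) = ws , All.map S⊆T ws∈S , z≈

  pow-+ : ∀ α m n → pow K α (m ℕ.+ n) ≈ pow K α m * pow K α n
  pow-+ α zero    n = sym (*-identityˡ _)
  pow-+ α (suc m) n = trans (*-congˡ (pow-+ α m n)) (sym (*-assoc _ _ _))

  pow-2^suc : ∀ α n → pow K α (2 ^ suc n) ≈ pow K α (2 ^ n) * pow K α (2 ^ n)
  pow-2^suc α n = trans (pow-+ α (2 ^ n) (2 ^ n ℕ.+ 0))
                        (*-congˡ (reflexive (≡.cong (pow K α) (ℕ.+-identityʳ (2 ^ n)))))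

  module Subfield {p} {S : Pred Carrier p} (S-isSubfield : IsSubfield S) where
    open IsSubfield S-isSubfield

    PolyValues⊆ : ∀ {α} → α ∈ S → PolyValues S α ⊆ S
    PolyValues⊆ {α} α∈S (ws , ws∈S , z≈) = ∈-resp-≈ (sym z≈) (horner∈ ws∈S)
      where
      horner∈ : ∀ {ws} → All S ws → horner α ws ∈ S
      horner∈ []             = 0∈
      horner∈ (w∈S ∷ ws∈S) = +-closed w∈S (*-closed α∈S (horner∈ ws∈S))

    -1∉S²⇒1+1≉0 : ¬ SquareIn S (- 1#) → ¬ 1# + 1# ≈ 0#
    -1∉S²⇒1+1≉0 -1∉S² 1+1≈0 =
      -1∉S² (1# , 1∈ , trans (*-identityʳ 1#) (inverseˡ-unique 1# 1# 1+1≈0))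

    -γ∉S²⇒anisotropic : ∀ {γ x y} → ¬ SquareIn S (- γ) → x ∈ S → y ∈ S →
                        x * x + γ * (y * y) ≈ 0# → ¬ ¬ y ≈ 0#
    -γ∉S²⇒anisotropic {γ} {x} {y} -γ∉S² x∈S y∈S x²+γy²≈0 y≉0 =
      let (v , v∈S , y*v≈1) = ⁻¹-closed y∈S y≉0 in
      -γ∉S² (x * v , *-closed x∈S v∈S , inverseˡ-unique _ _ (begin
        (x * v) * (x * v) + γ
          ≈⟨ +-congˡ (*-identityʳ γ) ⟨
        (x * v) * (x * v) + γ * 1#
          ≈⟨ +-congˡ (*-congˡ (trans (*-cong y*v≈1 y*v≈1) (*-identityʳ 1#))) ⟨
        (x * v) * (x * v) + γ * ((y * v) * (y * v))
          ≈⟨ solve 4 (λ x y v γ → (x :* v) :* (x :* v) :+ γ :* ((y :* v) :* (y :* v))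
                                  := (x :* x :+ γ :* (y :* y)) :* (v :* v)) refl x y v γ ⟩
        (x * x + γ * (y * y)) * (v * v)
          ≈⟨ *-congʳ x²+γy²≈0 ⟩
        0# * (v * v)
          ≈⟨ zeroˡ _ ⟩
        0# ∎))

    ¬[x²+γy²≈0∧xy+yx≈c] : ∀ {γ c x y} → ¬ c ≈ 0# → ¬ SquareIn S (- γ) → x ∈ S → y ∈ S →
                          ¬ (x * x + γ * (y * y) ≈ 0# × x * y + y * x ≈ c)
    ¬[x²+γy²≈0∧xy+yx≈c] {c = c} {x} {y} c≉0 -γ∉S² x∈S y∈S (x²+γy²≈0 , xy+yx≈c) =
      -γ∉S²⇒anisotropic -γ∉S² x∈S y∈S x²+γy²≈0 λ y≈0 → c≉0 (begin
        c              ≈⟨ xy+yx≈c ⟨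
        x * y + y * x  ≈⟨ +-cong (trans (*-congˡ y≈0) (zeroʳ x)) (trans (*-congʳ y≈0) (zeroˡ x)) ⟩
        0# + 0#        ≈⟨ +-identityʳ 0# ⟩
        0#             ∎)

    -- Since 1 + 1 ≠ 0, one of x, y vanishes: y = 0 makes -1 = x² a square, x = 0 makes 1² + γy² = 0.
    ¬[x²+γy²≈-1∧xy+yx≈0] : ∀ {γ x y} → ¬ SquareIn S (- 1#) → ¬ SquareIn S (- γ) → x ∈ S → y ∈ S →
                           ¬ (x * x + γ * (y * y) ≈ - 1# × x * y + y * x ≈ 0#)
    ¬[x²+γy²≈-1∧xy+yx≈0] {γ} {x} {y} -1∉S² -γ∉S² x∈S y∈S (x²+γy²≈-1 , xy+yx≈0) =
      -γ∉S²⇒anisotropic -γ∉S² 1∈ y∈S 1*1+γy²≈0 y≉0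
      where
      y≉0 : ¬ y ≈ 0#
      y≉0 y≈0 = -1∉S² (x , x∈S , (begin
        x * x                ≈⟨ +-identityʳ _ ⟨
        x * x + 0#           ≈⟨ +-congˡ (trans (*-congˡ (trans (*-congˡ y≈0) (zeroʳ y))) (zeroʳ γ)) ⟨
        x * x + γ * (y * y)  ≈⟨ x²+γy²≈-1 ⟩
        - 1#                 ∎))

      x≈0 : x ≈ 0#
      x≈0 = x*y≈0⇒x≈0 y≉0 (x*y≈0⇒x≈0 (-1∉S²⇒1+1≉0 -1∉S²) (begin
        (x * y) * (1# + 1#)      ≈⟨ distribˡ (x * y) 1# 1# ⟩
        x * y * 1# + x * y * 1#  ≈⟨ +-cong (*-identityʳ _) (trans (*-identityʳ _) (*-comm x y)) ⟩
        x * y + y * x            ≈⟨ xy+yx≈0 ⟩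
        0#                       ∎))

      1*1+γy²≈0 : 1# * 1# + γ * (y * y) ≈ 0#
      1*1+γy²≈0 = begin
        1# * 1# + γ * (y * y)          ≈⟨ +-congʳ (*-identityʳ 1#) ⟩
        1# + γ * (y * y)               ≈⟨ +-congˡ (+-identityˡ _) ⟨
        1# + (0# + γ * (y * y))        ≈⟨ +-congˡ (+-congʳ (trans (*-congʳ x≈0) (zeroˡ x))) ⟨
        1# + (x * x + γ * (y * y))     ≈⟨ +-congˡ x²+γy²≈-1 ⟩
        1# + - 1#                      ≈⟨ -‿inverseʳ 1# ⟩
        0#                             ∎

  module Quadratic {p} {S : Pred Carrier p} (S-isSubfield : IsSubfield S)
                   {γ g : Carrier} (γ∈S : γ ∈ S) (g*g≈γ : g * g ≈ γ) (γ∉S² : ¬ SquareIn S γ) where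
    open IsSubfield S-isSubfield
    open Subfield S-isSubfield

    S[g] : Pred Carrier (c ⊔ ℓ ⊔ p)
    S[g] w = ∃₂ λ x y → x ∈ S × y ∈ S × w ≈ x + y * g

    S⊆S[g] : S ⊆ S[g]
    S⊆S[g] {w} w∈S = w , 0# , w∈S , 0∈ , sym (trans (+-congˡ (zeroˡ g)) (+-identityʳ w))

    g∈S[g] : g ∈ S[g]
    g∈S[g] = 0# , 1# , 0∈ , 1∈ , sym (trans (+-identityˡ _) (*-identityˡ g))

    -- A dependence between 1 and g would put g in S, and then γ = g² in S².
    coordinates-unique : ∀ {a b a′ b′} → a ∈ S → b ∈ S → a′ ∈ S → b′ ∈ S →
                         a + b * g ≈ a′ + b′ * g → ¬ ¬ (a ≈ a′ × b ≈ b′)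
    coordinates-unique {a} {b} {a′} {b′} a∈S b∈S a′∈S b′∈S eq not-equal =
      let (y , y∈S , g≈y) = g∈S in γ∉S² (y , y∈S , trans (*-cong (sym g≈y) (sym g≈y)) g*g≈γ)
      where
      b≉b′ : ¬ b ≈ b′
      b≉b′ b≈b′ = not-equal (∙-cancelʳ (b * g) a a′ (trans eq (+-congˡ (*-congʳ (sym b≈b′)))) , b≈b′)

      [b-b′]*g≈a′-a : (b - b′) * g ≈ a′ - a
      [b-b′]*g≈a′-a = trans ([y-z]x≈yx-zx g b b′) (trans (y≈x\\z a _ a′ (begin
        a + (b * g - b′ * g)  ≈⟨ +-assoc a (b * g) (- (b′ * g)) ⟨
        a + b * g - b′ * g    ≈⟨ +-congʳ eq ⟩
        a′ + b′ * g - b′ * g  ≈⟨ //-rightDividesʳ (b′ * g) a′ ⟩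
        a′                    ∎)) (+-comm (- a) a′))

      g∈S : ∃ λ y → y ∈ S × g ≈ y
      g∈S = let (v , v∈S , [b-b′]*v≈1) = ⁻¹-closed (+-closed b∈S (-‿closed b′∈S))
                                                   (b≉b′ ∘′ x∙y⁻¹≈ε⇒x≈y b b′) in
        (a′ - a) * v , *-closed (+-closed a′∈S (-‿closed a∈S)) v∈S , (begin
          g                  ≈⟨ *-identityʳ g ⟨
          g * 1#             ≈⟨ *-congˡ [b-b′]*v≈1 ⟨
          g * ((b - b′) * v) ≈⟨ *-assoc g _ v ⟨
          (g * (b - b′)) * v ≈⟨ *-congʳ (*-comm g _) ⟩
          ((b - b′) * g) * v ≈⟨ *-congʳ [b-b′]*g≈a′-a ⟩
          (a′ - a) * v       ∎)

    x+0*g≈x : ∀ x → x + 0# * g ≈ x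
    x+0*g≈x x = trans (+-congˡ (zeroˡ g)) (+-identityʳ x)

    product-expand : ∀ x y x′ y′ → (x + y * g) * (x′ + y′ * g) ≈ (x * x′ + γ * (y * y′)) + (x * y′ + y * x′) * g
    product-expand x y x′ y′ = trans
      (solve 5 (λ x y x′ y′ g → (x :+ y :* g) :* (x′ :+ y′ :* g)
                                := (x :* x′ :+ (g :* g) :* (y :* y′)) :+ (x :* y′ :+ y :* x′) :* g)
             refl x y x′ y′ g)
      (+-congʳ (+-congˡ (*-congʳ g*g≈γ)))

    conjugate-product : ∀ x y → (x + y * g) * (x + (- y) * g) ≈ x * x + γ * (y * - y)
    conjugate-product x y = trans (product-expand x y x (- y)) (trans (+-congˡ (*-congʳ (begin
      x * - y + y * x      ≈⟨ +-cong (-‿distribʳ-* x y) (*-comm x y) ⟨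
      - (x * y) + x * y    ≈⟨ -‿inverseˡ (x * y) ⟩
      0#                   ∎))) (x+0*g≈x _))

    S[g]-⁻¹-closed : ∀ {w} → w ∈ S[g] → ¬ w ≈ 0# → ∃ λ u → u ∈ S[g] × w * u ≈ 1#
    S[g]-⁻¹-closed {w} (x , y , x∈S , y∈S , w≈) w≉0 =
      let (v , v∈S , N*v≈1) = ⁻¹-closed N∈S N≉0 in
      x * v + (- y * v) * g ,
      (x * v , - y * v , *-closed x∈S v∈S , *-closed (-‿closed y∈S) v∈S , refl) ,
      (begin
        w * (x * v + (- y * v) * g)             ≈⟨ *-congʳ w≈ ⟩
        (x + y * g) * (x * v + (- y * v) * g)   ≈⟨ solve 5 (λ x y y′ v g → (x :+ y :* g) :* (x :* v :+ (y′ :* v) :* g)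
                                                                := ((x :+ y :* g) :* (x :+ y′ :* g)) :* v)
                                                         refl x y (- y) v g ⟩
        ((x + y * g) * (x + (- y) * g)) * v     ≈⟨ *-congʳ (conjugate-product x y) ⟩
        N * v                                   ≈⟨ N*v≈1 ⟩
        1#                                      ∎)
      where
      N : Carrier
      N = x * x + γ * (y * - y)

      N∈S : N ∈ S
      N∈S = +-closed (*-closed x∈S x∈S) (*-closed γ∈S (*-closed y∈S (-‿closed y∈S)))

      N≉0 : ¬ N ≈ 0#
      N≉0 N≈0 = coordinates-unique x∈S (-‿closed y∈S) 0∈ 0∈ conjugate≈0 λ (x≈0 , -y≈0) → w≉0 (begin
        w            ≈⟨ w≈ ⟩
        x + y * g    ≈⟨ +-cong x≈0 (*-congʳ (-x≈0⇒x≈0 -y≈0)) ⟩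
        0# + 0# * g  ≈⟨ x+0*g≈x 0# ⟩
        0#           ∎)
        where
        conjugate≈0 : x + (- y) * g ≈ 0# + 0# * g
        conjugate≈0 = trans (x*y≈0⇒x≈0 w≉0 (trans (*-comm _ w)
                              (trans (*-congʳ w≈) (trans (conjugate-product x y) N≈0))))
                            (sym (x+0*g≈x 0#))

    S[g]-isSubfield : IsSubfield S[g]
    S[g]-isSubfield = record
      { ∈-resp-≈  = λ { w≈w′ (x , y , x∈S , y∈S , w≈) → x , y , x∈S , y∈S , trans (sym w≈w′) w≈ }
      ; 0∈        = S⊆S[g] 0∈
      ; 1∈        = S⊆S[g] 1∈
      ; +-closed  = λ { (x , y , x∈S , y∈S , w≈) (x′ , y′ , x′∈S , y′∈S , w′≈) →
          x + x′ , y + y′ , +-closed x∈S x′∈S , +-closed y∈S y′∈S ,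
          trans (+-cong w≈ w′≈)
                (solve 5 (λ x y x′ y′ g → (x :+ y :* g) :+ (x′ :+ y′ :* g) := (x :+ x′) :+ (y :+ y′) :* g)
                       refl x y x′ y′ g) }
      ; *-closed  = λ { (x , y , x∈S , y∈S , w≈) (x′ , y′ , x′∈S , y′∈S , w′≈) →
          x * x′ + γ * (y * y′) , x * y′ + y * x′ ,
          +-closed (*-closed x∈S x′∈S) (*-closed γ∈S (*-closed y∈S y′∈S)) ,
          +-closed (*-closed x∈S y′∈S) (*-closed y∈S x′∈S) ,
          trans (*-cong w≈ w′≈) (product-expand x y x′ y′) }
      ; -‿closed  = λ { (x , y , x∈S , y∈S , w≈) →
          - x , - y , -‿closed x∈S , -‿closed y∈S ,
          trans (-‿cong w≈) (trans (sym (⁻¹-∙-comm x (y * g))) (+-congˡ (-‿distribˡ-* y g))) }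
      ; ⁻¹-closed = S[g]-⁻¹-closed
      }

    square-coordinates : ∀ {t₀ t₁} → t₀ ∈ S → t₁ ∈ S → SquareIn S[g] (t₀ + t₁ * g) →
                         ∃₂ λ x y → x ∈ S × y ∈ S × ¬ ¬ (x * x + γ * (y * y) ≈ t₀ × x * y + y * x ≈ t₁)
    square-coordinates t₀∈S t₁∈S (w , (x , y , x∈S , y∈S , w≈) , w*w≈t) =
      x , y , x∈S , y∈S ,
      coordinates-unique (+-closed (*-closed x∈S x∈S) (*-closed γ∈S (*-closed y∈S y∈S)))
                         (+-closed (*-closed x∈S y∈S) (*-closed y∈S x∈S)) t₀∈S t₁∈S
                         (trans (sym (product-expand x y x y)) (trans (*-cong (sym w≈) (sym w≈)) w*w≈t))

    -1∉S[g]² : ¬ SquareIn S (- 1#) → ¬ SquareIn S (- γ) → ¬ SquareIn S[g] (- 1#)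
    -1∉S[g]² -1∉S² -γ∉S² -1∈S[g]² =
      let (x , y , x∈S , y∈S , coordinates) =
            square-coordinates (-‿closed 1∈) 0∈ (SquareIn-resp-≈ (sym (x+0*g≈x (- 1#))) -1∈S[g]²)
      in coordinates (¬[x²+γy²≈-1∧xy+yx≈0] -1∉S² -γ∉S² x∈S y∈S)

    c*g∉S[g]² : ∀ {c} → c ∈ S → ¬ c ≈ 0# → ¬ SquareIn S (- γ) → ¬ SquareIn S[g] (c * g)
    c*g∉S[g]² c∈S c≉0 -γ∉S² c*g∈S[g]² =
      let (x , y , x∈S , y∈S , coordinates) =
            square-coordinates 0∈ c∈S (SquareIn-resp-≈ (sym (+-identityˡ _)) c*g∈S[g]²)
      in coordinates (¬[x²+γy²≈0∧xy+yx≈c] c≉0 -γ∉S² x∈S y∈S)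

    g∉S[g]² : ¬ SquareIn S (- γ) → ¬ SquareIn S[g] g
    g∉S[g]² -γ∉S² = c*g∉S[g]² 1∈ 1≉0 -γ∉S² ∘′ SquareIn-resp-≈ (sym (*-identityˡ g))

    -g∉S[g]² : ¬ SquareIn S (- γ) → ¬ SquareIn S[g] (- g)
    -g∉S[g]² -γ∉S² = c*g∉S[g]² (-‿closed 1∈) (1≉0 ∘′ -x≈0⇒x≈0) -γ∉S² ∘′ SquareIn-resp-≈ (sym (-1*x≈-x g))

  -1∉PolyValues² : ∀ n {p} {S : Pred Carrier p} → IsSubfield S → ∀ {γ} → γ ∈ S →
                   ¬ SquareIn S (- 1#) → ¬ SquareIn S γ → ¬ SquareIn S (- γ) →
                   ∀ {α} → pow K α (2 ^ n) ≈ γ → ¬ SquareIn (PolyValues S α) (- 1#)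
  -1∉PolyValues² zero S-isSubfield γ∈S -1∉S² γ∉S² -γ∉S² {α} α*1≈γ =
    -1∉S² ∘′ SquareIn-mono (PolyValues⊆ (∈-resp-≈ (trans (sym α*1≈γ) (*-identityʳ α)) γ∈S))
    where
    open IsSubfield S-isSubfield
    open Subfield S-isSubfield
  -1∉PolyValues² (suc n) S-isSubfield γ∈S -1∉S² γ∉S² -γ∉S² {α} α^2^[1+n]≈γ =
    -1∉PolyValues² n S[g]-isSubfield g∈S[g] (-1∉S[g]² -1∉S² -γ∉S²) (g∉S[g]² -γ∉S²) (-g∉S[g]² -γ∉S²) refl
    ∘′ SquareIn-mono (PolyValues-mono S⊆S[g])
    where
    open Quadratic S-isSubfield γ∈S (trans (sym (pow-2^suc α n)) α^2^[1+n]≈γ) γ∉S²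

module _ {c ℓ c′ ℓ′} {F : Field c ℓ} (E : Extension F c′ ℓ′) where
  open Extension E
  private module F = Field F
  open Field K
  open RingMorphisms F.rawRing rawRing using (module IsRingHomomorphism)
  private module ι = IsRingHomomorphism ι-hom
  import Algebra.Properties.Group as GroupProperties
  open GroupProperties +-group using (x≈y⇒x∙y⁻¹≈ε)
  open GroupProperties F.+-group using (x∙y⁻¹≈ε⇒x≈y)
  open import Relation.Binary.Reasoning.Setoid setoid

  Image : Pred Carrier (c ⊔ ℓ′)
  Image z = ∃ λ u → z ≈ ι u

  Image-isSubfield : IsSubfield K Image
  Image-isSubfield = record
    { ∈-resp-≈  = λ { z≈z′ (u , z≈) → u , trans (sym z≈z′) z≈ }
    ; 0∈        = F.0# , sym ι.0#-homo
    ; 1∈        = F.1# , sym ι.1#-homo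
    ; +-closed  = λ { (u , z≈) (u′ , z′≈) → u F.+ u′ , trans (+-cong z≈ z′≈) (sym (ι.+-homo u u′)) }
    ; *-closed  = λ { (u , z≈) (u′ , z′≈) → u F.* u′ , trans (*-cong z≈ z′≈) (sym (ι.*-homo u u′)) }
    ; -‿closed  = λ { (u , z≈) → F.- u , trans (-‿cong z≈) (sym (ι.-‿homo u)) }
    ; ⁻¹-closed = λ { {z} (u , z≈) z≉0 →
        let (u⁻¹ , u*u⁻¹≈1) = F.inverse u (z≉0 ∘′ λ u≈0 → trans z≈ (trans (ι.⟦⟧-cong u≈0) ι.0#-homo)) in
        ι u⁻¹ , (u⁻¹ , refl) ,
        trans (*-congʳ z≈) (trans (sym (ι.*-homo u u⁻¹)) (trans (ι.⟦⟧-cong u*u⁻¹≈1) ι.1#-homo)) }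
    }

  ι-injective : ∀ {u v} → ι u ≈ ι v → ¬ ¬ u F.≈ v
  ι-injective {u} {v} ιu≈ιv u≉v =
    let (d , [u-v]*d≈1) = F.inverse (u F.- v) (u≉v ∘′ x∙y⁻¹≈ε⇒x≈y u v) in
    1≉0 (begin
      1#                    ≈⟨ ι.1#-homo ⟨
      ι F.1#                ≈⟨ ι.⟦⟧-cong [u-v]*d≈1 ⟨
      ι ((u F.- v) F.* d)   ≈⟨ ι.*-homo _ d ⟩
      ι (u F.- v) * ι d     ≈⟨ *-congʳ (trans (ι.+-homo u (F.- v)) (+-congˡ (ι.-‿homo v))) ⟩
      (ι u - ι v) * ι d     ≈⟨ *-congʳ (x≈y⇒x∙y⁻¹≈ε ιu≈ιv) ⟩
      0# * ι d              ≈⟨ zeroˡ (ι d) ⟩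
      0#                    ∎)

  nonsquare-image : ∀ {b} → ¬ IsSquare F b → ¬ SquareIn K Image (ι b)
  nonsquare-image {b} b∉F² (z , (u , z≈ιu) , z*z≈ιb) =
    ι-injective (trans (ι.*-homo u u) (trans (*-cong (sym z≈ιu) (sym z≈ιu)) z*z≈ιb)) (b∉F² ∘′ (u ,_))

  evalAt≈horner : ∀ α cs → evalAt E α cs ≈ horner K α (map ι cs)
  evalAt≈horner α []       = refl
  evalAt≈horner α (u ∷ cs) = +-congˡ (*-congˡ (evalAt≈horner α cs))

  InAdjoin⊆PolyValues : ∀ {α} → InAdjoin E α ⊆ PolyValues K Image α
  InAdjoin⊆PolyValues {α} (cs , z≈) = map ι cs , image∈ cs , trans z≈ (evalAt≈horner α cs)
    where
    image∈ : ∀ cs → All Image (map ι cs)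
    image∈ []       = []
    image∈ (u ∷ cs) = (u , refl) ∷ image∈ cs

lemma2 : ∀ {c ℓ c′ ℓ′} (F : Field c ℓ) (a : Field.Carrier F)
         → ¬ IsSquare F (Field.-_ F (Field.1# F))
         → ¬ IsSquare F a
         → ¬ IsSquare F (Field.-_ F a)
         → (n : ℕ) (E : Extension F c′ ℓ′) (α : Field.Carrier (Extension.K E))
         → Field._≈_ (Extension.K E) (pow (Extension.K E) α (2 ^ n)) (Extension.ι E a)
         → ¬ (∃ λ z → InAdjoin E α z
              × Field._≈_ (Extension.K E) (Field._*_ (Extension.K E) z z)
                          (Field.-_ (Extension.K E) (Field.1# (Extension.K E))))
lemma2 F a -1∉F² a∉F² -a∉F² n E α α^2^n≈a (z , z∈F[α] , z*z≈-1) =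
  -1∉PolyValues² K n (Image-isSubfield E) (a , refl)
    (nonsquare-image E -1∉F² ∘′ SquareIn-resp-≈ K (sym ι[-1]≈-1))
    (nonsquare-image E a∉F²)
    (nonsquare-image E -a∉F² ∘′ SquareIn-resp-≈ K (sym (ι.-‿homo a)))
    α^2^n≈a
    (z , InAdjoin⊆PolyValues E z∈F[α] , z*z≈-1)
  where
  open Extension E
  open Field K
  module ι = RingMorphisms.IsRingHomomorphism ι-hom

  ι[-1]≈-1 : ι (Field.-_ F (Field.1# F)) ≈ - 1#
  ι[-1]≈-1 = trans (ι.-‿homo _) (-‿cong ι.1#-homo)
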